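{- Let $u,v$ be positive integers with $uv>1$ and let $z$ be a positive rational number. Let $A^{(u,v)}(z;n)=2^{ -n}\sum_{y\in\mathcal{T}^{(u,v)}(z;n)}y$. Then $A^{(u,v)}(z;n)$ is bounded above for all $n\ge 0$. In particular, $$v+\frac{\log 2}{u}-\lim_{n\to\infty}A^{(u,v)}(z;n)=O\!\left(\frac{1}{u^2v}\right),$$ that is, the absolute value of the left-hand side is at most $C/(u^2v)$ for a constant $C$ not depending on $u$ and $v$.
   Context: The $(u,v)$-Calkin-Wilf tree $\mathcal{T}^{(u,v)}(z)$ with root a positive rational $z$ is the infinite binary tree whose root is labeled $z$ and in which every vertex labeled $a/b$ (with $a,b$ positive integers) has left child labeled $a/(ua+b)$ and right child labeled $(a+vb)/b$. $\mathcal{T}^{(u,v)}(z;n)$ denotes the collection of the $2^n$ vertices at depth $n$ (the root has depth $0$), and the sum runs over these $2^n$ vertices. -}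

module Defs where

open import Data.Nat as ℕ using (ℕ; zero; suc; NonZero)
open import Data.Nat.Properties using (m^n≢0; m*n≢0)
open import Data.Integer as ℤ using (ℤ; +_; -[1+_])
open import Data.Rational as ℚ using (ℚ; _/_; 0ℚ)
open import Data.List using (List; []; _∷_; concatMap; map; foldr)
open import Data.Product using (_×_; _,_)

-- A vertex of the tree is stored as a pair (a , b') of natural numbers,
-- representing the fraction a / (b' + 1) (so the denominator is positive).
Vertex : Set
Vertex = ℕ × ℕ

label : Vertex → ℚ
label (a , b') = (+ a) / suc b'

-- Children of a / b in the (u,v)-Calkin-Wilf tree:
--   left  child  a / (u a + b),   right child  (a + v b) / b.
-- With b = b' + 1 we have u a + b = suc (u a + b').
children : ℕ → ℕ → Vertex → List Vertex
children u v (a , b') = (a , u ℕ.* a ℕ.+ b') ∷ (a ℕ.+ v ℕ.* suc b' , b') ∷ []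

rootOf : ℚ → Vertex
rootOf z = (ℤ.∣ ℚ.↥ z ∣ , ℚ.denominator-1 z)

-- T^{(u,v)}(z;n): the 2^n vertices at depth n (listed with multiplicity).
level : ℕ → ℕ → ℚ → ℕ → List Vertex
level u v z zero    = rootOf z ∷ []
level u v z (suc n) = concatMap (children u v) (level u v z n)

sumℚ : List ℚ → ℚ
sumℚ = foldr ℚ._+_ 0ℚ

A : ℕ → ℕ → ℚ → ℕ → ℚ
A u v z n = ℚ._*_ (_/_ (+ 1) (2 ℕ.^ n) {{m^n≢0 2 n}}) (sumℚ (map label (level u v z n)))

ℕ→ℚ : ℕ → ℚ
ℕ→ℚ n = (+ n) / 1

inv : (n : ℕ) → .{{NonZero n}} → ℚ
inv n = (+ 1) / n

-- Partial sums of the alternating harmonic series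
--   altH m = Σ_{k=1}^{m} (-1)^{k+1} / k,   which converge to log 2.
altH : ℕ → ℚ
altH zero = 0ℚ
altH (suc m) = altH m ℚ.+ term m
  where
  sign : ℕ → ℤ
  sign zero = + 1
  sign (suc zero) = -[1+ 0 ]
  sign (suc (suc k)) = sign k
  term : ℕ → ℚ
  term m = (sign m) / suc m

-- Cauchy sequence of rationals (= convergent as a real sequence).
IsCauchy : (ℕ → ℚ) → Set
IsCauchy f = ∀ (ε : ℚ) → ℚ.Positive ε →
  Data.Product.∃ λ N → ∀ m n → N ℕ.≤ m → N ℕ.≤ n → ℚ.∣ f m ℚ.- f n ∣ ℚ.≤ ε

{-# OPTIONS --safe #-}
-- Averaging over the two children is the operator P f p = ½ (f (L p) + f (R p)), so that
-- A n = Pⁿ label (root). As label ∘ R = label + v, A (n+1) = ½ A n + ½ (v + Gₙ) with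
-- Gₙ = Pⁿ (label ∘ L) (root), and A follows v + lim G up to a geometrically decaying error.
--
-- G converges: label ∘ L is 1-Lipschitz for the distance |x - y|/(x + y) of labels x, y;
-- L and R preserve |ad - bc| and do not decrease ad + bc, while LR and RL multiply ad + bc
-- by at least 1 + 2uv ≥ 5. Hence P⁴ halves Lipschitz constants and Pⁿ (label ∘ L) flattens.
--
-- The limit: label (Lʲ⁺¹ (R p)) lies within 1/(u²v) below 1/((j+1)u), so Gₙ is within
-- 1/(u²v) of (1/u) Σ_{k<n} 1/(2ᵏ⁺¹ (k+1)), the Euler transform of the alternating harmonic
-- series. The two are compared through the Beta integrals β j k = j! k!/(j+k+1)!, which
-- satisfy β j k = β (j+1) k + β j (k+1).

module Submission where

open import Defs
open import Data.Nat as ℕ using (ℕ; NonZero; zero; suc; _!)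
open import Data.Nat.Properties using (m*n≢0)
import Data.Nat.Properties as ℕP
open import Data.Integer as ℤ using (ℤ; +_; -[1+_]; +[1+_])
import Data.Integer.Properties as ℤP
open import Data.Rational as ℚ using (ℚ; _+_; _-_; _*_; _≤_; ∣_∣; Positive; _/_; 0ℚ; 1ℚ; ½; toℚᵘ)
import Data.Rational.Properties as ℚP
open import Data.Rational.Unnormalised as ℚᵘ using (mkℚᵘ)
import Data.Rational.Unnormalised.Properties as ℚᵘP
import Data.Rational.Solver as ℚSolver
open import Data.Nat.Tactic.RingSolver using (solve-∀)
open import Data.Product using (_×_; _,_; ∃; proj₁; proj₂)
open import Data.Sum using (inj₁; inj₂)
open import Data.List using ([]; _∷_; concatMap; map)
open import Relation.Binary.PropositionalEquality

open ℚSolver.+-*-Solver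

toℚᵘ-/ : ∀ i d → toℚᵘ (i / suc d) ℚᵘ.≃ mkℚᵘ i d
toℚᵘ-/ i d = ℚP.toℚᵘ-fromℚᵘ (mkℚᵘ i d)

frac-cong : ∀ {i j} {m n} .{{_ : NonZero m}} .{{_ : NonZero n}} → i ≡ j → m ≡ n → i / m ≡ j / n
frac-cong refl refl = refl

frac-≤ : ∀ (i j : ℤ) m n .{{_ : NonZero m}} .{{_ : NonZero n}} →
         i ℤ.* + n ℤ.≤ j ℤ.* + m → i / m ≤ j / n
frac-≤ i j (suc m) (suc n) h = ℚP.toℚᵘ-cancel-≤
  (ℚᵘP.≤-respˡ-≃ (ℚᵘP.≃-sym (toℚᵘ-/ i m)) (ℚᵘP.≤-respʳ-≃ (ℚᵘP.≃-sym (toℚᵘ-/ j n)) (ℚᵘ.*≤* h)))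

fracℕ-≤ : ∀ a c m n .{{_ : NonZero m}} .{{_ : NonZero n}} →
          a ℕ.* n ℕ.≤ c ℕ.* m → (+ a) / m ≤ (+ c) / n
fracℕ-≤ a c m n h = frac-≤ (+ a) (+ c) m n (subst₂ ℤ._≤_ (ℤP.pos-* a n) (ℤP.pos-* c m) (ℤ.+≤+ h))

fracℕ-≡ : ∀ a c m n .{{_ : NonZero m}} .{{_ : NonZero n}} →
          a ℕ.* n ≡ c ℕ.* m → (+ a) / m ≡ (+ c) / n
fracℕ-≡ a c m n h =
  ℚP.≤-antisym (fracℕ-≤ a c m n (ℕP.≤-reflexive h)) (fracℕ-≤ c a n m (ℕP.≤-reflexive (sym h)))

frac-+ : ∀ (i j : ℤ) m n .{{_ : NonZero m}} .{{_ : NonZero n}} →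
         i / m + j / n ≡ ((i ℤ.* + n ℤ.+ j ℤ.* + m) / (m ℕ.* n)) {{m*n≢0 m n}}
frac-+ i j (suc m) (suc n) = ℚP.toℚᵘ-injective (ℚᵘP.≃-trans (ℚP.toℚᵘ-homo-+ (i / suc m) (j / suc n))
  (ℚᵘP.≃-trans (ℚᵘP.+-cong (toℚᵘ-/ i m) (toℚᵘ-/ j n)) (ℚᵘP.≃-sym (toℚᵘ-/ _ _))))

fracℕ-+ : ∀ a c m n .{{_ : NonZero m}} .{{_ : NonZero n}} →
          (+ a) / m + (+ c) / n ≡ ((+ (a ℕ.* n ℕ.+ c ℕ.* m)) / (m ℕ.* n)) {{m*n≢0 m n}}
fracℕ-+ a c m n = trans (frac-+ (+ a) (+ c) m n) (frac-cong {{m*n≢0 m n}} {{m*n≢0 m n}} numerator refl)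
  where
  numerator : + a ℤ.* + n ℤ.+ + c ℤ.* + m ≡ + (a ℕ.* n ℕ.+ c ℕ.* m)
  numerator = trans (cong₂ ℤ._+_ (sym (ℤP.pos-* a n)) (sym (ℤP.pos-* c m))) (sym (ℤP.pos-+ (a ℕ.* n) (c ℕ.* m)))

frac-* : ∀ (i j : ℤ) m n .{{_ : NonZero m}} .{{_ : NonZero n}} →
         (i / m) * (j / n) ≡ ((i ℤ.* j) / (m ℕ.* n)) {{m*n≢0 m n}}
frac-* i j (suc m) (suc n) = ℚP.toℚᵘ-injective (ℚᵘP.≃-trans (ℚP.toℚᵘ-homo-* (i / suc m) (j / suc n))
  (ℚᵘP.≃-trans (ℚᵘP.*-cong (toℚᵘ-/ i m) (toℚᵘ-/ j n)) (ℚᵘP.≃-sym (toℚᵘ-/ _ _))))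

frac-neg : ∀ (i : ℤ) m .{{_ : NonZero m}} → ℚ.- (i / m) ≡ (ℤ.- i) / m
frac-neg i (suc m) = ℚP.toℚᵘ-injective (ℚᵘP.≃-trans (ℚP.toℚᵘ-homo‿- (i / suc m))
  (ℚᵘP.≃-trans (ℚᵘP.-‿cong (toℚᵘ-/ i m)) (ℚᵘP.≃-sym (toℚᵘ-/ _ _))))

ℕ→ℚ-nonNeg : ∀ n → 0ℚ ≤ ℕ→ℚ n
ℕ→ℚ-nonNeg n = fracℕ-≤ 0 n 1 1 ℕ.z≤n

ℕ→ℚ-mono-≤ : ∀ {m n} → m ℕ.≤ n → ℕ→ℚ m ≤ ℕ→ℚ n
ℕ→ℚ-mono-≤ {m} {n} h = fracℕ-≤ m n 1 1 (ℕP.*-monoˡ-≤ 1 h)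

ℕ→ℚ-+ : ∀ m n → ℕ→ℚ (m ℕ.+ n) ≡ ℕ→ℚ m + ℕ→ℚ n
ℕ→ℚ-+ m n = sym (trans (frac-+ (+ m) (+ n) 1 1)
  (frac-cong (trans (cong₂ ℤ._+_ (ℤP.*-identityʳ (+ m)) (ℤP.*-identityʳ (+ n))) (sym (ℤP.pos-+ m n))) refl))

ℕ→ℚ-* : ∀ m n → ℕ→ℚ (m ℕ.* n) ≡ ℕ→ℚ m * ℕ→ℚ n
ℕ→ℚ-* m n = sym (trans (frac-* (+ m) (+ n) 1 1) (frac-cong (sym (ℤP.pos-* m n)) refl))

ℕ→ℚ-pos : ∀ n → 1 ℕ.≤ n → Positive (ℕ→ℚ n)
ℕ→ℚ-pos (suc n) _ = ℚP.normalize-pos (suc n) 1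

0≤½ : 0ℚ ≤ ½
0≤½ = ℚP.nonNegative⁻¹ ½

0≤1 : 0ℚ ≤ 1ℚ
0≤1 = ℚP.nonNegative⁻¹ 1ℚ

≤-by-gap : ∀ {x y} d → 0ℚ ≤ d → y ≡ x + d → x ≤ y
≤-by-gap {x} d h eq = subst₂ _≤_ (ℚP.+-identityʳ x) (sym eq) (ℚP.+-monoʳ-≤ x h)

p≤q⇒0≤q-p : ∀ {p q} → p ≤ q → 0ℚ ≤ q - p
p≤q⇒0≤q-p {p} {q} h = subst (_≤ q - p) (ℚP.+-inverseʳ p) (ℚP.+-monoˡ-≤ (ℚ.- p) h)

+-nonNeg : ∀ {p q} → 0ℚ ≤ p → 0ℚ ≤ q → 0ℚ ≤ p + q
+-nonNeg = ℚP.+-mono-≤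

*-monoˡ-≤-0≤ : ∀ {r p q} → 0ℚ ≤ r → p ≤ q → r * p ≤ r * q
*-monoˡ-≤-0≤ {r} h = ℚP.*-monoˡ-≤-nonNeg r {{ℚ.nonNegative h}}

*-monoʳ-≤-0≤ : ∀ {r p q} → 0ℚ ≤ r → p ≤ q → p * r ≤ q * r
*-monoʳ-≤-0≤ {r} h = ℚP.*-monoʳ-≤-nonNeg r {{ℚ.nonNegative h}}

*-nonNeg : ∀ {p q} → 0ℚ ≤ p → 0ℚ ≤ q → 0ℚ ≤ p * q
*-nonNeg {p} hp hq = subst (_≤ p * _) (ℚP.*-zeroʳ p) (*-monoˡ-≤-0≤ hp hq)

½-pos : ∀ ε → Positive ε → Positive (½ * ε)
½-pos ε pos = ℚP.pos*pos⇒pos ½ ε {{pos}}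

½+½ : ∀ ε → ½ * ε + ½ * ε ≡ ε
½+½ = solve 1 (λ ε → con ½ :* ε :+ con ½ :* ε := ε) refl

infix 4 _≈[_]_

_≈[_]_ : ℚ → ℚ → ℚ → Set
x ≈[ e ] y = (x ≤ y + e) × (y ≤ x + e)

≈⇒∣-∣≤ : ∀ {x y e} → x ≈[ e ] y → ∣ x - y ∣ ≤ e
≈⇒∣-∣≤ {x} {y} {e} (x≤y+e , y≤x+e) with ℚP.∣p∣≡p∨∣p∣≡-p (x - y)
... | inj₁ eq = subst (_≤ e) (sym eq) (≤-by-gap _ (p≤q⇒0≤q-p x≤y+e)
      (solve 3 (λ x y e → e := (x :- y) :+ ((y :+ e) :- x)) refl x y e))
... | inj₂ eq = subst (_≤ e) (sym eq) (≤-by-gap _ (p≤q⇒0≤q-p y≤x+e)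
      (solve 3 (λ x y e → e := (:- (x :- y)) :+ ((x :+ e) :- y)) refl x y e))

≈-sym : ∀ {x y e} → x ≈[ e ] y → y ≈[ e ] x
≈-sym (x≤y+e , y≤x+e) = y≤x+e , x≤y+e

≈-weaken : ∀ {x y e e′} → e ≤ e′ → x ≈[ e ] y → x ≈[ e′ ] y
≈-weaken {x} {y} e≤e′ (x≤y+e , y≤x+e) =
  ℚP.≤-trans x≤y+e (ℚP.+-monoʳ-≤ y e≤e′) , ℚP.≤-trans y≤x+e (ℚP.+-monoʳ-≤ x e≤e′)

≈-trans : ∀ {x y w e₁ e₂} → x ≈[ e₁ ] y → y ≈[ e₂ ] w → x ≈[ e₁ + e₂ ] w
≈-trans {x} {y} {w} {e₁} {e₂} (x≤ , y≤) (y≤′ , w≤) =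
  ℚP.≤-trans x≤ (ℚP.≤-trans (ℚP.+-monoˡ-≤ e₁ y≤′) (ℚP.≤-reflexive
    (solve 3 (λ w e₁ e₂ → w :+ e₂ :+ e₁ := w :+ (e₁ :+ e₂)) refl w e₁ e₂))) ,
  ℚP.≤-trans w≤ (ℚP.≤-trans (ℚP.+-monoˡ-≤ e₂ y≤) (ℚP.≤-reflexive (ℚP.+-assoc x e₁ e₂)))

≈-+ˡ : ∀ {x y e} c → x ≈[ e ] y → c + x ≈[ e ] c + y
≈-+ˡ {x} {y} {e} c (x≤ , y≤) =
  ℚP.≤-trans (ℚP.+-monoʳ-≤ c x≤) (ℚP.≤-reflexive (sym (ℚP.+-assoc c y e))) ,
  ℚP.≤-trans (ℚP.+-monoʳ-≤ c y≤) (ℚP.≤-reflexive (sym (ℚP.+-assoc c x e)))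

≈-*ˡ : ∀ {x y e} α → 0ℚ ≤ α → x ≈[ e ] y → α * x ≈[ α * e ] α * y
≈-*ˡ {x} {y} {e} α 0≤α (x≤ , y≤) =
  ℚP.≤-trans (*-monoˡ-≤-0≤ 0≤α x≤) (ℚP.≤-reflexive (ℚP.*-distribˡ-+ α y e)) ,
  ℚP.≤-trans (*-monoˡ-≤-0≤ 0≤α y≤) (ℚP.≤-reflexive (ℚP.*-distribˡ-+ α x e))

≈-+ : ∀ {x y a b e₁ e₂} → x ≈[ e₁ ] y → a ≈[ e₂ ] b → x + a ≈[ e₁ + e₂ ] y + b
≈-+ {x} {y} {a} {b} {e₁} {e₂} (x≤ , y≤) (a≤ , b≤) =
  ℚP.≤-trans (ℚP.+-mono-≤ x≤ a≤) (ℚP.≤-reflexive (shuffle y b e₁ e₂)) ,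
  ℚP.≤-trans (ℚP.+-mono-≤ y≤ b≤) (ℚP.≤-reflexive (shuffle x a e₁ e₂))
  where
  shuffle : ∀ p q d₁ d₂ → p + d₁ + (q + d₂) ≡ p + q + (d₁ + d₂)
  shuffle = solve 4 (λ p q d₁ d₂ → p :+ d₁ :+ (q :+ d₂) := p :+ q :+ (d₁ :+ d₂)) refl

≈-+ʳ : ∀ {x y e} c → x ≈[ e ] y → x + c ≈[ e ] y + c
≈-+ʳ {x} {y} c x≈y = subst₂ (_≈[ _ ]_) (ℚP.+-comm c x) (ℚP.+-comm c y) (≈-+ˡ c x≈y)

≈-within : ∀ {x y e} → 0ℚ ≤ x → x ≤ e → 0ℚ ≤ y → y ≤ e → x ≈[ e ] y
≈-within {x} {y} {e} 0≤x x≤e 0≤y y≤e =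
  ℚP.≤-trans x≤e (subst (_≤ y + e) (ℚP.+-identityˡ e) (ℚP.+-monoˡ-≤ e 0≤y)) ,
  ℚP.≤-trans y≤e (subst (_≤ x + e) (ℚP.+-identityˡ e) (ℚP.+-monoˡ-≤ e 0≤x))

infix 9 ½^_

½^_ : ℕ → ℚ
½^ zero  = 1ℚ
½^ suc n = ½ * ½^ n

½^-nonNeg : ∀ n → 0ℚ ≤ ½^ n
½^-nonNeg zero    = 0≤1
½^-nonNeg (suc n) = *-nonNeg 0≤½ (½^-nonNeg n)

½^≤1 : ∀ n → ½^ n ≤ 1ℚ
½^≤1 zero    = ℚP.≤-refl
½^≤1 (suc n) = ℚP.≤-trans (*-monoˡ-≤-0≤ 0≤½ (½^≤1 n)) (fracℕ-≤ 1 1 2 1 (ℕ.s≤s ℕ.z≤n))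

½^-+ : ∀ m k → ½^ (m ℕ.+ k) ≤ ½^ m
½^-+ zero    k = ½^≤1 k
½^-+ (suc m) k = *-monoˡ-≤-0≤ 0≤½ (½^-+ m k)

½^-antimono : ∀ {m n} → m ℕ.≤ n → ½^ n ≤ ½^ m
½^-antimono {m} {n} m≤n = subst (λ k → ½^ k ≤ ½^ m) (ℕP.m+[n∸m]≡n m≤n) (½^-+ m (n ℕ.∸ m))

½^≡1/2^ : ∀ n → ½^ n ≡ ((+ 1) / (2 ℕ.^ n)) {{ℕP.m^n≢0 2 n}}
½^≡1/2^ zero    = refl
½^≡1/2^ (suc n) = trans (cong (½ *_) (½^≡1/2^ n)) (frac-* (+ 1) (+ 1) 2 (2 ℕ.^ n) {{_}} {{ℕP.m^n≢0 2 n}})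

n<2^n : ∀ n → n ℕ.< 2 ℕ.^ n
n<2^n zero    = ℕ.s≤s ℕ.z≤n
n<2^n (suc n) = ℕP.+-mono-≤ (ℕP.m^n>0 2 n) (ℕP.≤-trans (n<2^n n) (ℕP.m≤m+n _ 0))

inv-nonNeg : ∀ j → 0ℚ ≤ inv (suc j)
inv-nonNeg j = fracℕ-≤ 0 1 1 (suc j) ℕ.z≤n

inv≤1 : ∀ j → inv (suc j) ≤ 1ℚ
inv≤1 j = fracℕ-≤ 1 1 (suc j) 1 (ℕ.s≤s ℕ.z≤n)

½^≤inv : ∀ n → ½^ n ≤ inv (suc n)
½^≤inv n = ℚP.≤-trans (ℚP.≤-reflexive (½^≡1/2^ n))
  (fracℕ-≤ 1 1 (2 ℕ.^ n) (suc n) {{ℕP.m^n≢0 2 n}} (ℕP.*-monoʳ-≤ 1 (n<2^n n)))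

inv-antimono : ∀ {m n} → m ℕ.≤ n → inv (suc n) ≤ inv (suc m)
inv-antimono m≤n = fracℕ-≤ 1 1 _ _ (ℕP.*-monoʳ-≤ 1 (ℕ.s≤s m≤n))

archimedean-inv : ∀ ε → Positive ε → ∀ N → ∃ λ K → ℕ→ℚ N * inv (suc K) ≤ ε
archimedean-inv ε@(ℚ.mkℚ +[1+ p ] d _) _ N = N ℕ.* suc d , (begin
  ℕ→ℚ N * inv (suc K)            ≡⟨ frac-* (+ N) (+ 1) 1 (suc K) ⟩
  (+ N ℤ.* + 1) / (1 ℕ.* suc K)  ≡⟨ frac-cong (ℤP.*-identityʳ (+ N)) (ℕP.*-identityˡ (suc K)) ⟩
  (+ N) / suc K                  ≤⟨ fracℕ-≤ N (suc p) (suc K) (suc d) N*[1+d]≤[1+p]*[1+K] ⟩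
  (+ suc p) / suc d              ≡⟨ ℚP.↥p/↧p≡p ε ⟩
  ε                              ∎)
  where
  open ℚP.≤-Reasoning
  K = N ℕ.* suc d
  N*[1+d]≤[1+p]*[1+K] : N ℕ.* suc d ℕ.≤ suc p ℕ.* suc K
  N*[1+d]≤[1+p]*[1+K] = ℕP.≤-trans (ℕP.n≤1+n K) (ℕP.m≤n*m (suc K) (suc p))

archimedean-½^ : ∀ ε → Positive ε → ∀ N → ∃ λ K → ℕ→ℚ N * ½^ K ≤ ε
archimedean-½^ ε pos N with archimedean-inv ε pos N
... | K , N/K≤ε = K , ℚP.≤-trans (*-monoˡ-≤-0≤ (ℕ→ℚ-nonNeg N) (½^≤inv K)) N/K≤ε

near⇒IsCauchy : ∀ {f : ℕ → ℚ} →
  (∀ ε → Positive ε → ∃ λ N → ∃ λ c → ∀ m → N ℕ.≤ m → f m ≈[ ε ] c) → IsCauchy f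
near⇒IsCauchy {f} near ε pos with near (½ * ε) (½-pos ε pos)
... | N , c , f≈c = N , λ m n N≤m N≤n →
  subst (∣ f m - f n ∣ ≤_) (½+½ ε) (≈⇒∣-∣≤ (≈-trans (f≈c m N≤m) (≈-sym (f≈c n N≤n))))

module Tracking (a g : ℕ → ℚ) (w : ℚ) (a-suc : ∀ n → a (suc n) ≡ ½ * a n + ½ * (w + g n)) where

  tracks : ∀ {B c η N} → 0ℚ ≤ η → (∀ n → a n ≈[ B ] w + c) → (∀ t → g (N ℕ.+ t) ≈[ η ] c) →
           ∀ t → a (N ℕ.+ t) ≈[ ½^ t * B + η ] w + c
  tracks {B} {c} {η} {N} 0≤η bound g≈c zero =
    ≈-weaken (≤-by-gap η 0≤η (cong (_+ η) (ℚP.*-identityˡ B))) (bound (N ℕ.+ 0))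
  tracks {B} {c} {η} {N} 0≤η bound g≈c (suc t) =
    subst₂ (λ x y → x ≈[ ½^ suc t * B + η ] y) (sym (trans (cong a (ℕP.+-suc N t)) (a-suc (N ℕ.+ t)))) (½+½ (w + c))
      (≈-weaken (ℚP.≤-reflexive error)
        (≈-+ (≈-*ˡ ½ 0≤½ (tracks 0≤η bound g≈c t)) (≈-*ˡ ½ 0≤½ (≈-+ˡ w (g≈c t)))))
    where
    error : ½ * (½^ t * B + η) + ½ * η ≡ ½^ suc t * B + η
    error = solve 3 (λ h B η → con ½ :* (h :* B :+ η) :+ con ½ :* η := con ½ :* h :* B :+ η) refl (½^ t) B η

  eventually-near : ∀ {b c η N} → 0ℚ ≤ η → (∀ n → a n ≈[ ℕ→ℚ b ] w + c) →
                    (∀ t → g (N ℕ.+ t) ≈[ η ] c) →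
                    ∀ ε → Positive ε → ∃ λ M → ∀ m → M ℕ.≤ m → a m ≈[ η + ε ] w + c
  eventually-near {b} {c} {η} {N} 0≤η bound g≈c ε pos with archimedean-½^ ε pos b
  ... | T , b½ᵀ≤ε = N ℕ.+ T , λ m N+T≤m →
    subst (λ k → a k ≈[ η + ε ] w + c) (ℕP.m+[n∸m]≡n (ℕP.≤-trans (ℕP.m≤m+n N T) N+T≤m))
      (≈-weaken (small (m ℕ.∸ N) (ℕP.≤-trans (ℕP.≤-reflexive (sym (ℕP.m+n∸m≡n N T))) (ℕP.∸-monoˡ-≤ N N+T≤m)))
        (tracks 0≤η bound g≈c (m ℕ.∸ N)))
    where
    small : ∀ t → T ℕ.≤ t → ½^ t * ℕ→ℚ b + η ≤ η + ε
    small t T≤t = ℚP.≤-trans (ℚP.+-monoˡ-≤ η (ℚP.≤-trans (*-monoʳ-≤-0≤ (ℕ→ℚ-nonNeg b) (½^-antimono T≤t))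
      (subst (_≤ ε) (ℚP.*-comm (ℕ→ℚ b) (½^ T)) b½ᵀ≤ε))) (ℚP.≤-reflexive (ℚP.+-comm ε η))

sign : ℕ → ℤ
sign zero          = + 1
sign (suc zero)    = -[1+ 0 ]
sign (suc (suc k)) = sign k

ℕ-ind₂ : (P : ℕ → Set) → P 0 → P 1 → (∀ k → P k → P (suc (suc k))) → ∀ k → P k
ℕ-ind₂ P p₀ p₁ step zero          = p₀
ℕ-ind₂ P p₀ p₁ step (suc zero)    = p₁
ℕ-ind₂ P p₀ p₁ step (suc (suc k)) = step k (ℕ-ind₂ P p₀ p₁ step k)

-- The sign in Defs.altH is computed by a where-local function, which cannot be
-- named here; the statement of altH-sign is inferred from its use in altH-suc.
mutual
  altH-sign : ∀ (q : ℚ) w k → _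
  altH-sign q w = ℕ-ind₂ _ refl refl (λ _ eq → eq)

  altH-suc : ∀ m → altH (suc m) ≡ altH m + sign m / suc m
  altH-suc zero          = refl
  altH-suc (suc zero)    = refl
  altH-suc (suc (suc k)) with altH (suc (suc k))
  ... | q with suc (suc k)
  ... | w = altH-sign q w k

signℚ : ℕ → ℚ
signℚ n = sign n / 1

signℚ-suc : ∀ n → signℚ (suc n) ≡ ℚ.- signℚ n
signℚ-suc zero          = refl
signℚ-suc (suc zero)    = refl
signℚ-suc (suc (suc n)) = signℚ-suc n

signℚ-*-≈0 : ∀ n {t e} → 0ℚ ≤ t → t ≤ e → signℚ n * t ≈[ e ] 0ℚ
signℚ-*-≈0 zero {t} {e} 0≤t t≤e =
  subst₂ _≤_ (sym (ℚP.*-identityˡ t)) (sym (ℚP.+-identityˡ e)) t≤e ,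
  ≤-by-gap (1ℚ * t + e) (+-nonNeg (subst (0ℚ ≤_) (sym (ℚP.*-identityˡ t)) 0≤t) (ℚP.≤-trans 0≤t t≤e))
    (sym (ℚP.+-identityˡ _))
signℚ-*-≈0 (suc zero) {t} {e} 0≤t t≤e =
  ≤-by-gap (t + e) (+-nonNeg 0≤t (ℚP.≤-trans 0≤t t≤e))
    (solve 2 (λ t e → con 0ℚ :+ e := (:- con 1ℚ) :* t :+ (t :+ e)) refl t e) ,
  ≤-by-gap (e - t) (p≤q⇒0≤q-p t≤e)
    (solve 2 (λ t e → (:- con 1ℚ) :* t :+ e := con 0ℚ :+ (e :- t)) refl t e)
signℚ-*-≈0 (suc (suc n)) = signℚ-*-≈0 n

-- The Beta integral ∫₀¹ xʲ (1 - x)ᵏ dx.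
β : ℕ → ℕ → ℚ
β j k = ((+ (j ! ℕ.* k !)) / (suc (j ℕ.+ k)) !) {{(suc (j ℕ.+ k)) ℕP.!≢0}}

j!k!≤[j+k]! : ∀ j k → j ! ℕ.* k ! ℕ.≤ (j ℕ.+ k) !
j!k!≤[j+k]! j zero = ℕP.≤-reflexive (trans (ℕP.*-identityʳ (j !)) (cong _! (sym (ℕP.+-identityʳ j))))
j!k!≤[j+k]! j (suc k) = begin
  j ! ℕ.* (suc k ℕ.* k !)        ≡⟨ swap (j !) (suc k) (k !) ⟩
  suc k ℕ.* (j ! ℕ.* k !)        ≤⟨ ℕP.*-mono-≤ (ℕ.s≤s (ℕP.m≤n+m k j)) (j!k!≤[j+k]! j k) ⟩
  suc (j ℕ.+ k) ℕ.* (j ℕ.+ k) !  ≡⟨ cong _! (sym (ℕP.+-suc j k)) ⟩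
  (j ℕ.+ suc k) !                ∎
  where
  open ℕP.≤-Reasoning
  swap : ∀ a b c → a ℕ.* (b ℕ.* c) ≡ b ℕ.* (a ℕ.* c)
  swap = solve-∀

β-nonNeg : ∀ j k → 0ℚ ≤ β j k
β-nonNeg j k = fracℕ-≤ 0 (j ! ℕ.* k !) 1 ((suc (j ℕ.+ k)) !) {{_}} {{(suc (j ℕ.+ k)) ℕP.!≢0}} ℕ.z≤n

β≤inv : ∀ j k → β j k ≤ inv (suc (j ℕ.+ k))
β≤inv j k = fracℕ-≤ (j ! ℕ.* k !) 1 ((suc (j ℕ.+ k)) !) (suc (j ℕ.+ k)) {{(suc (j ℕ.+ k)) ℕP.!≢0}}
  (ℕP.≤-trans (ℕP.≤-reflexive (ℕP.*-comm (j ! ℕ.* k !) (suc (j ℕ.+ k))))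
    (ℕP.≤-trans (ℕP.*-monoʳ-≤ (suc (j ℕ.+ k)) (j!k!≤[j+k]! j k)) (ℕP.≤-reflexive (sym (ℕP.*-identityˡ _)))))

β-zeroʳ : ∀ j → β j 0 ≡ inv (suc j)
β-zeroʳ j = fracℕ-≡ (j ! ℕ.* 1) 1 ((suc (j ℕ.+ 0)) !) (suc j) {{(suc (j ℕ.+ 0)) ℕP.!≢0}}
  (trans (lemma (j !) j) (cong (λ i → 1 ℕ.* (suc i) !) (sym (ℕP.+-identityʳ j))))
  where
  lemma : ∀ a j → a ℕ.* 1 ℕ.* suc j ≡ 1 ℕ.* (suc j ℕ.* a)
  lemma = solve-∀

β-zeroˡ : ∀ k → β 0 k ≡ inv (suc k)
β-zeroˡ k = fracℕ-≡ (1 ℕ.* k !) 1 ((suc k) !) (suc k) {{(suc k) ℕP.!≢0}} (lemma (k !) k)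
  where
  lemma : ∀ a k → 1 ℕ.* a ℕ.* suc k ≡ 1 ℕ.* (suc k ℕ.* a)
  lemma = solve-∀

β-split : ∀ j k → β j k ≡ β (suc j) k + β j (suc k)
β-split j k = sym (begin
  β (suc j) k + β j (suc k)              ≡⟨ cong (λ x → β (suc j) k + x) same-denominator ⟩
  (+ X) / D + (+ Y) / D                   ≡⟨ fracℕ-+ X Y D D ⟩
  (+ (X ℕ.* D ℕ.+ Y ℕ.* D)) / (D ℕ.* D)  ≡⟨ fracℕ-≡ (X ℕ.* D ℕ.+ Y ℕ.* D) (j ! ℕ.* k !) (D ℕ.* D) h cross ⟩
  β j k                                   ∎)
  where
  open ≡-Reasoning
  h = (suc (j ℕ.+ k)) !
  D = (suc (suc (j ℕ.+ k))) !
  X = (suc j) ! ℕ.* k !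
  Y = j ! ℕ.* (suc k) !
  instance
    D≢0 : NonZero D
    D≢0 = (suc (suc (j ℕ.+ k))) ℕP.!≢0
    h≢0 : NonZero h
    h≢0 = (suc (j ℕ.+ k)) ℕP.!≢0
    D*D≢0 : NonZero (D ℕ.* D)
    D*D≢0 = m*n≢0 D D
  same-denominator : β j (suc k) ≡ (+ Y) / D
  same-denominator = frac-cong {+ Y} {{(suc (j ℕ.+ suc k)) ℕP.!≢0}} refl (cong (λ i → (suc i) !) (ℕP.+-suc j k))
  cross : (X ℕ.* D ℕ.+ Y ℕ.* D) ℕ.* h ≡ (j ! ℕ.* k !) ℕ.* (D ℕ.* D)
  cross = lemma (j !) (k !) h j k
    where
    lemma : ∀ a b c j k →
      (suc j ℕ.* a ℕ.* b ℕ.* ((2 ℕ.+ (j ℕ.+ k)) ℕ.* c) ℕ.+ a ℕ.* (suc k ℕ.* b) ℕ.* ((2 ℕ.+ (j ℕ.+ k)) ℕ.* c)) ℕ.* c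
      ≡ a ℕ.* b ℕ.* ((2 ℕ.+ (j ℕ.+ k)) ℕ.* c ℕ.* ((2 ℕ.+ (j ℕ.+ k)) ℕ.* c))
    lemma = solve-∀

β-rec : ∀ j k → β (suc j) k ≡ β j k - β j (suc k)
β-rec j k = sym (trans (cong (_- β j (suc k)) (β-split j k))
  (solve 2 (λ a b → (a :+ b) :- b := a) refl (β (suc j) k) (β j (suc k))))

altβ : ℕ → ℕ → ℚ
altβ zero    j = 0ℚ
altβ (suc N) j = altβ N j + signℚ N * β j N

-- euler n j = Σ_{k<n} 1 / (2^(k+1) (j+k+1)); euler n 0 is the Euler transform of altH.
euler : ℕ → ℕ → ℚ
euler zero    j = 0ℚ
euler (suc n) j = ½ * inv (suc j) + ½ * euler n (suc j)

altH≡altβ : ∀ N → altH N ≡ altβ N 0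
altH≡altβ zero    = refl
altH≡altβ (suc N) = trans (altH-suc N) (cong₂ _+_ (altH≡altβ N) (sym last-term))
  where
  last-term : signℚ N * β 0 N ≡ sign N / suc N
  last-term = trans (cong (signℚ N *_) (β-zeroˡ N)) (trans (frac-* (sign N) (+ 1) 1 (suc N))
    (frac-cong (ℤP.*-identityʳ (sign N)) (ℕP.*-identityˡ (suc N))))

-- One step of the Euler transform: summation by parts along β-rec.
altβ-suc : ∀ N j → altβ (suc N) j ≡ ½ * (β j 0 + altβ N (suc j) + signℚ N * β j N)
altβ-suc zero j = solve 1 (λ t → con 0ℚ :+ con 1ℚ :* t := con ½ :* (t :+ con 0ℚ :+ con 1ℚ :* t)) refl (β j 0)
altβ-suc (suc N) j = begin
  altβ (suc N) j + signℚ (suc N) * β j (suc N)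
    ≡⟨ cong₂ (λ a s → a + s * β j (suc N)) (altβ-suc N j) (signℚ-suc N) ⟩
  ½ * (β j 0 + altβ N (suc j) + s * β j N) + (ℚ.- s) * β j (suc N)
    ≡⟨ solve 5 (λ t₀ a s b b′ → con ½ :* (t₀ :+ a :+ s :* b) :+ (:- s) :* b′
                 := con ½ :* (t₀ :+ (a :+ s :* (b :- b′)) :+ (:- s) :* b′)) refl
         (β j 0) (altβ N (suc j)) s (β j N) (β j (suc N)) ⟩
  ½ * (β j 0 + (altβ N (suc j) + s * (β j N - β j (suc N))) + (ℚ.- s) * β j (suc N))
    ≡⟨ cong₂ (λ b t → ½ * (β j 0 + (altβ N (suc j) + s * b) + t * β j (suc N))) (sym (β-rec j N)) (sym (signℚ-suc N)) ⟩
  ½ * (β j 0 + altβ (suc N) (suc j) + signℚ (suc N) * β j (suc N)) ∎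
  where
  open ≡-Reasoning
  s = signℚ N

euler-nonNeg : ∀ n j → 0ℚ ≤ euler n j
euler-nonNeg zero    j = ℚP.≤-refl
euler-nonNeg (suc n) j = +-nonNeg (*-nonNeg 0≤½ (inv-nonNeg j)) (*-nonNeg 0≤½ (euler-nonNeg n (suc j)))

euler≤inv : ∀ n j → euler n j ≤ inv (suc j)
euler≤inv zero    j = inv-nonNeg j
euler≤inv (suc n) j = begin
  ½ * inv (suc j) + ½ * euler n (suc j)  ≤⟨ ℚP.+-monoʳ-≤ (½ * inv (suc j)) (*-monoˡ-≤-0≤ 0≤½
                                             (ℚP.≤-trans (euler≤inv n (suc j)) (inv-antimono (ℕP.n≤1+n j)))) ⟩
  ½ * inv (suc j) + ½ * inv (suc j)      ≡⟨ ½+½ (inv (suc j)) ⟩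
  inv (suc j)                            ∎
  where open ℚP.≤-Reasoning

altβ≈euler : ∀ N j → altβ (suc N) j ≈[ inv (suc (N ℕ.+ j)) ] euler (suc N) j
altβ≈euler zero j = ≈-within
  (subst (0ℚ ≤_) (sym altβ₁) (inv-nonNeg j)) (ℚP.≤-reflexive altβ₁)
  (euler-nonNeg 1 j) (euler≤inv 1 j)
  where
  altβ₁ : altβ 1 j ≡ inv (suc j)
  altβ₁ = trans (solve 1 (λ t → con 0ℚ :+ con 1ℚ :* t := t) refl (β j 0)) (β-zeroʳ j)
altβ≈euler (suc N) j = subst₂ (_≈[ inv (suc (suc N ℕ.+ j)) ]_) (sym altβ-split) euler-split
  (≈-weaken (ℚP.≤-reflexive error) (≈-+ˡ (½ * inv (suc j)) (≈-*ˡ ½ 0≤½ (≈-+ (altβ≈euler N (suc j))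
    (signℚ-*-≈0 (suc N) (β-nonNeg j (suc N)) (β≤inv j (suc N)))))))
  where
  altβ-split : altβ (suc (suc N)) j ≡ ½ * inv (suc j) + ½ * (altβ (suc N) (suc j) + signℚ (suc N) * β j (suc N))
  altβ-split = trans (altβ-suc (suc N) j)
    (trans (cong (λ t → ½ * (t + altβ (suc N) (suc j) + signℚ (suc N) * β j (suc N))) (β-zeroʳ j))
      (solve 4 (λ t a s b → con ½ :* (t :+ a :+ s :* b) := con ½ :* t :+ con ½ :* (a :+ s :* b)) refl
        (inv (suc j)) (altβ (suc N) (suc j)) (signℚ (suc N)) (β j (suc N))))
  euler-split : ½ * inv (suc j) + ½ * (euler (suc N) (suc j) + 0ℚ) ≡ euler (suc (suc N)) j
  euler-split = cong (λ x → ½ * inv (suc j) + ½ * x) (ℚP.+-identityʳ (euler (suc N) (suc j)))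
  error : ½ * (inv (suc (N ℕ.+ suc j)) + inv (suc (j ℕ.+ suc N))) ≡ inv (suc (suc N ℕ.+ j))
  error = trans (cong₂ (λ a b → ½ * (inv (suc a) + inv (suc b))) (ℕP.+-suc N j)
                  (trans (ℕP.+-suc j N) (cong suc (ℕP.+-comm j N))))
    (solve 1 (λ x → con ½ :* (x :+ x) := x) refl (inv (suc (suc N ℕ.+ j))))

euler-+-≈ : ∀ n t j → euler (n ℕ.+ t) j ≈[ ½^ n ] euler n j
euler-+-≈ zero t j = ≈-within (euler-nonNeg t j) (ℚP.≤-trans (euler≤inv t j) (inv≤1 j)) ℚP.≤-refl 0≤1
euler-+-≈ (suc n) t j = ≈-+ˡ (½ * inv (suc j)) (≈-*ˡ ½ 0≤½ (euler-+-≈ n t (suc j)))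

altH≈euler : ∀ K m → K ℕ.< m → altH m ≈[ inv (suc K) + ½^ K ] euler K 0
altH≈euler K (suc m) (ℕ.s≤s K≤m) = subst (_≈[ inv (suc K) + ½^ K ] euler K 0) (sym (altH≡altβ (suc m)))
  (≈-trans (≈-weaken (inv-antimono (ℕP.≤-trans K≤m (ℕP.≤-reflexive (sym (ℕP.+-identityʳ m))))) (altβ≈euler m 0))
    (subst (λ n → euler n 0 ≈[ ½^ K ] euler K 0) (ℕP.m+[n∸m]≡n (ℕP.m≤n⇒m≤1+n K≤m))
      (euler-+-≈ K (suc m ℕ.∸ K) 0)))

module Tree (u′ v′ : ℕ) where

  u v : ℕ
  u = suc u′
  v = suc v′

  L R : Vertex → Vertex
  L (a , b) = (a , u ℕ.* a ℕ.+ b)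
  R (a , b) = (a ℕ.+ v ℕ.* suc b , b)

  -- For labels x = a/(b+1) and y = c/(d+1), Δ/σ is the distance |x - y|/(x + y).
  σ Δ : Vertex → Vertex → ℕ
  σ (a , b) (c , d) = a ℕ.* suc d ℕ.+ c ℕ.* suc b
  Δ (a , b) (c , d) = ℕ.∣ a ℕ.* suc d - c ℕ.* suc b ∣

  Stretches : ℕ → (Vertex → Vertex) → Set
  Stretches m w = ∀ p q → m ℕ.* σ p q ℕ.≤ σ (w p) (w q)

  Preserves-Δ : (Vertex → Vertex) → Set
  Preserves-Δ w = ∀ p q → Δ (w p) (w q) ≡ Δ p q

  Preserves-Δ-∘ : ∀ w₁ w₂ → Preserves-Δ w₁ → Preserves-Δ w₂ → Preserves-Δ (λ p → w₂ (w₁ p))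
  Preserves-Δ-∘ w₁ w₂ h₁ h₂ p q = trans (h₂ (w₁ p) (w₁ q)) (h₁ p q)

  Stretches-∘ : ∀ m n w₁ w₂ → Stretches m w₁ → Stretches n w₂ → Stretches (n ℕ.* m) (λ p → w₂ (w₁ p))
  Stretches-∘ m n w₁ w₂ h₁ h₂ p q = ℕP.≤-trans (ℕP.≤-reflexive (ℕP.*-assoc n m (σ p q)))
    (ℕP.≤-trans (ℕP.*-monoʳ-≤ n (h₁ p q)) (h₂ (w₁ p) (w₁ q)))

  Δ-L : Preserves-Δ L
  Δ-L (a , b) (c , d) = trans (cong₂ ℕ.∣_-_∣ (expandˡ a c d u) (expandʳ a b c u))
    (ℕP.∣m+n-m+o∣≡∣n-o∣ (u ℕ.* a ℕ.* c) (a ℕ.* suc d) (c ℕ.* suc b))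
    where
    expandˡ : ∀ a c d u → a ℕ.* suc (u ℕ.* c ℕ.+ d) ≡ u ℕ.* a ℕ.* c ℕ.+ a ℕ.* suc d
    expandˡ = solve-∀
    expandʳ : ∀ a b c u → c ℕ.* suc (u ℕ.* a ℕ.+ b) ≡ u ℕ.* a ℕ.* c ℕ.+ c ℕ.* suc b
    expandʳ = solve-∀

  Δ-R : Preserves-Δ R
  Δ-R (a , b) (c , d) = trans (cong₂ ℕ.∣_-_∣ (expandˡ a b d v) (expandʳ b c d v))
    (ℕP.∣m+n-m+o∣≡∣n-o∣ (v ℕ.* suc b ℕ.* suc d) (a ℕ.* suc d) (c ℕ.* suc b))
    where
    expandˡ : ∀ a b d v → (a ℕ.+ v ℕ.* suc b) ℕ.* suc d ≡ v ℕ.* suc b ℕ.* suc d ℕ.+ a ℕ.* suc d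
    expandˡ = solve-∀
    expandʳ : ∀ b c d v → (c ℕ.+ v ℕ.* suc d) ℕ.* suc b ≡ v ℕ.* suc b ℕ.* suc d ℕ.+ c ℕ.* suc b
    expandʳ = solve-∀

  σ-L : Stretches 1 L
  σ-L (a , b) (c , d) = ℕP.≤-trans (ℕP.m≤m+n _ (2 ℕ.* u ℕ.* a ℕ.* c)) (ℕP.≤-reflexive (expand a b c d u))
    where
    expand : ∀ a b c d u → 1 ℕ.* (a ℕ.* suc d ℕ.+ c ℕ.* suc b) ℕ.+ 2 ℕ.* u ℕ.* a ℕ.* c
                           ≡ a ℕ.* suc (u ℕ.* c ℕ.+ d) ℕ.+ c ℕ.* suc (u ℕ.* a ℕ.+ b)
    expand = solve-∀

  σ-R : Stretches 1 R
  σ-R (a , b) (c , d) = ℕP.≤-trans (ℕP.m≤m+n _ (2 ℕ.* v ℕ.* suc b ℕ.* suc d)) (ℕP.≤-reflexive (expand a b c d v))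
    where
    expand : ∀ a b c d v → 1 ℕ.* (a ℕ.* suc d ℕ.+ c ℕ.* suc b) ℕ.+ 2 ℕ.* v ℕ.* suc b ℕ.* suc d
                           ≡ (a ℕ.+ v ℕ.* suc b) ℕ.* suc d ℕ.+ (c ℕ.+ v ℕ.* suc d) ℕ.* suc b
    expand = solve-∀

  -- Mixing a left and a right step multiplies σ by at least 1 + 2uv.
  module _ (uv≥2 : 2 ℕ.≤ u ℕ.* v) where

    5σ≤σ+2uvσ : ∀ s → 5 ℕ.* s ℕ.≤ s ℕ.+ 2 ℕ.* (u ℕ.* v) ℕ.* s
    5σ≤σ+2uvσ s = ℕP.+-monoʳ-≤ s (ℕP.*-monoˡ-≤ s (ℕP.*-monoʳ-≤ 2 uv≥2))

    σ-LR : Stretches 5 (λ p → L (R p))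
    σ-LR p@(a , b) q@(c , d) = ℕP.≤-trans (5σ≤σ+2uvσ (σ p q)) (ℕP.≤-trans (ℕP.m≤m+n _ _) (ℕP.≤-reflexive
      (sym (expand a b c d u v))))
      where
      expand : ∀ a b c d u v →
        (a ℕ.+ v ℕ.* suc b) ℕ.* suc (u ℕ.* (c ℕ.+ v ℕ.* suc d) ℕ.+ d) ℕ.+ (c ℕ.+ v ℕ.* suc d) ℕ.* suc (u ℕ.* (a ℕ.+ v ℕ.* suc b) ℕ.+ b)
        ≡ (a ℕ.* suc d ℕ.+ c ℕ.* suc b) ℕ.+ 2 ℕ.* (u ℕ.* v) ℕ.* (a ℕ.* suc d ℕ.+ c ℕ.* suc b)
          ℕ.+ (2 ℕ.* v ℕ.* suc b ℕ.* suc d ℕ.+ 2 ℕ.* u ℕ.* (a ℕ.* c ℕ.+ v ℕ.* v ℕ.* suc b ℕ.* suc d))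
      expand = solve-∀

    σ-RL : Stretches 5 (λ p → R (L p))
    σ-RL p@(a , b) q@(c , d) = ℕP.≤-trans (5σ≤σ+2uvσ (σ p q)) (ℕP.≤-trans (ℕP.m≤m+n _ _) (ℕP.≤-reflexive
      (sym (expand a b c d u v))))
      where
      expand : ∀ a b c d u v →
        (a ℕ.+ v ℕ.* suc (u ℕ.* a ℕ.+ b)) ℕ.* suc (u ℕ.* c ℕ.+ d) ℕ.+ (c ℕ.+ v ℕ.* suc (u ℕ.* c ℕ.+ d)) ℕ.* suc (u ℕ.* a ℕ.+ b)
        ≡ (a ℕ.* suc d ℕ.+ c ℕ.* suc b) ℕ.+ 2 ℕ.* (u ℕ.* v) ℕ.* (a ℕ.* suc d ℕ.+ c ℕ.* suc b)
          ℕ.+ (2 ℕ.* u ℕ.* a ℕ.* c ℕ.+ 2 ℕ.* v ℕ.* (u ℕ.* u ℕ.* a ℕ.* c ℕ.+ suc b ℕ.* suc d))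
      expand = solve-∀

  Δ≤σ : ∀ p q → Δ p q ℕ.≤ σ p q
  Δ≤σ (a , b) (c , d) =
    ℕP.≤-trans (ℕP.∣m-n∣≤m⊔n (a ℕ.* suc d) (c ℕ.* suc b)) (ℕP.m⊔n≤m+n (a ℕ.* suc d) (c ℕ.* suc b))

  σ-pos : ∀ p q → 1 ℕ.≤ proj₁ p → 1 ℕ.≤ σ p q
  σ-pos (a , b) (c , d) 1≤a =
    ℕP.≤-trans (ℕP.*-mono-≤ 1≤a (ℕ.s≤s (ℕ.z≤n {d}))) (ℕP.m≤m+n (a ℕ.* suc d) (c ℕ.* suc b))

  P : (Vertex → ℚ) → Vertex → ℚ
  P f p = ½ * (f (L p) + f (R p))

  Pⁿ : ℕ → (Vertex → ℚ) → Vertex → ℚ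
  Pⁿ zero    f = f
  Pⁿ (suc n) f = Pⁿ n (P f)

  Pⁿ-cong : ∀ n {f g} → (∀ p → f p ≡ g p) → ∀ q → Pⁿ n f q ≡ Pⁿ n g q
  Pⁿ-cong zero    f≡g q = f≡g q
  Pⁿ-cong (suc n) f≡g q = Pⁿ-cong n (λ p → cong₂ (λ x y → ½ * (x + y)) (f≡g (L p)) (f≡g (R p))) q

  Pⁿ-mono : ∀ n {f g} → (∀ p → f p ≤ g p) → ∀ q → Pⁿ n f q ≤ Pⁿ n g q
  Pⁿ-mono zero    f≤g q = f≤g q
  Pⁿ-mono (suc n) f≤g q = Pⁿ-mono n (λ p → *-monoˡ-≤-0≤ 0≤½ (ℚP.+-mono-≤ (f≤g (L p)) (f≤g (R p)))) q

  Pⁿ-+ : ∀ n f g q → Pⁿ n (λ p → f p + g p) q ≡ Pⁿ n f q + Pⁿ n g q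
  Pⁿ-+ zero    f g q = refl
  Pⁿ-+ (suc n) f g q = trans (Pⁿ-cong n (λ p → distrib (f (L p)) (f (R p)) (g (L p)) (g (R p))) q) (Pⁿ-+ n (P f) (P g) q)
    where
    distrib : ∀ a b c d → ½ * ((a + c) + (b + d)) ≡ ½ * (a + b) + ½ * (c + d)
    distrib = solve 4 (λ a b c d → con ½ :* ((a :+ c) :+ (b :+ d)) := con ½ :* (a :+ b) :+ con ½ :* (c :+ d)) refl

  Pⁿ-* : ∀ n α f q → Pⁿ n (λ p → α * f p) q ≡ α * Pⁿ n f q
  Pⁿ-* zero    α f q = refl
  Pⁿ-* (suc n) α f q = trans (Pⁿ-cong n (λ p → distrib α (f (L p)) (f (R p))) q) (Pⁿ-* n α (P f) q)
    where
    distrib : ∀ α a b → ½ * (α * a + α * b) ≡ α * (½ * (a + b))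
    distrib = solve 3 (λ α a b → con ½ :* (α :* a :+ α :* b) := α :* (con ½ :* (a :+ b))) refl

  Pⁿ-const : ∀ n c q → Pⁿ n (λ _ → c) q ≡ c
  Pⁿ-const zero    c q = refl
  Pⁿ-const (suc n) c q = trans (Pⁿ-cong n (λ _ → ½-mean c) q) (Pⁿ-const n c q)
    where
    ½-mean : ∀ c → ½ * (c + c) ≡ c
    ½-mean = solve 1 (λ c → con ½ :* (c :+ c) := c) refl

  Pⁿ-+ℕ : ∀ m n f q → Pⁿ (m ℕ.+ n) f q ≡ Pⁿ n (Pⁿ m f) q
  Pⁿ-+ℕ zero    n f q = refl
  Pⁿ-+ℕ (suc m) n f q = Pⁿ-+ℕ m n (P f) q

  Pⁿ-+const : ∀ n f c q → Pⁿ n (λ p → f p + c) q ≡ Pⁿ n f q + c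
  Pⁿ-+const n f c q = trans (Pⁿ-+ n f (λ _ → c) q) (cong (λ x → Pⁿ n f q + x) (Pⁿ-const n c q))

  Pⁿ-≤-const : ∀ n {f} c → (∀ p → f p ≤ c) → ∀ q → Pⁿ n f q ≤ c
  Pⁿ-≤-const n c f≤c q = ℚP.≤-trans (Pⁿ-mono n f≤c q) (ℚP.≤-reflexive (Pⁿ-const n c q))

  Pⁿ-≥-const : ∀ n {f} c → (∀ p → c ≤ f p) → ∀ q → c ≤ Pⁿ n f q
  Pⁿ-≥-const n c c≤f q = ℚP.≤-trans (ℚP.≤-reflexive (sym (Pⁿ-const n c q))) (Pⁿ-mono n c≤f q)

  Pⁿ-≈ : ∀ n {f g e} → (∀ p → f p ≈[ e ] g p) → ∀ q → Pⁿ n f q ≈[ e ] Pⁿ n g q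
  Pⁿ-≈ n {f} {g} {e} f≈g q =
    ℚP.≤-trans (Pⁿ-mono n (λ p → proj₁ (f≈g p)) q) (ℚP.≤-reflexive (Pⁿ-+const n g e q)) ,
    ℚP.≤-trans (Pⁿ-mono n (λ p → proj₂ (f≈g p)) q) (ℚP.≤-reflexive (Pⁿ-+const n f e q))

  Lipschitz : ℚ → (Vertex → ℚ) → Set
  Lipschitz K f = ∀ p q → (f p - f q) * ℕ→ℚ (σ p q) ≤ K * ℕ→ℚ (Δ p q)

  Lipschitz-weaken : ∀ {K K′ f} → K ≤ K′ → Lipschitz K f → Lipschitz K′ f
  Lipschitz-weaken K≤K′ lip p q = ℚP.≤-trans (lip p q) (*-monoʳ-≤-0≤ (ℕ→ℚ-nonNeg (Δ p q)) K≤K′)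

  Lipschitz-stretch : ∀ m w {K f} → Stretches m w → Preserves-Δ w → 0ℚ ≤ K → Lipschitz K f →
    ∀ p q → ℕ→ℚ m * ((f (w p) - f (w q)) * ℕ→ℚ (σ p q)) ≤ K * ℕ→ℚ (Δ p q)
  Lipschitz-stretch m w {K} {f} stretch keepΔ 0≤K lip p q with ℚP.≤-total 0ℚ (f (w p) - f (w q))
  ... | inj₁ 0≤D = begin
    ℕ→ℚ m * (D * ℕ→ℚ (σ p q))       ≡⟨ swap (ℕ→ℚ m) D (ℕ→ℚ (σ p q)) ⟩
    D * (ℕ→ℚ m * ℕ→ℚ (σ p q))       ≡⟨ cong (D *_) (sym (ℕ→ℚ-* m (σ p q))) ⟩
    D * ℕ→ℚ (m ℕ.* σ p q)            ≤⟨ *-monoˡ-≤-0≤ 0≤D (ℕ→ℚ-mono-≤ (stretch p q)) ⟩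
    D * ℕ→ℚ (σ (w p) (w q))          ≤⟨ lip (w p) (w q) ⟩
    K * ℕ→ℚ (Δ (w p) (w q))          ≡⟨ cong (λ n → K * ℕ→ℚ n) (keepΔ p q) ⟩
    K * ℕ→ℚ (Δ p q)                  ∎
    where
    open ℚP.≤-Reasoning
    D = f (w p) - f (w q)
    swap : ∀ a b c → a * (b * c) ≡ b * (a * c)
    swap = solve 3 (λ a b c → a :* (b :* c) := b :* (a :* c)) refl
  ... | inj₂ D≤0 = ℚP.≤-trans
      (≤-by-gap _ (*-nonNeg (ℕ→ℚ-nonNeg m) (*-nonNeg (p≤q⇒0≤q-p D≤0) (ℕ→ℚ-nonNeg (σ p q))))
        (solve 3 (λ a b c → con 0ℚ := a :* (b :* c) :+ a :* ((con 0ℚ :- b) :* c)) refl (ℕ→ℚ m) D (ℕ→ℚ (σ p q))))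
      (*-nonNeg 0≤K (ℕ→ℚ-nonNeg (Δ p q)))
    where D = f (w p) - f (w q)

  module _ (uv≥2 : 2 ℕ.≤ u ℕ.* v) where

    -- (1 + 1/5 + 1/5 + 1)/4 = 3/5, from the four grandchildren LL, RL, LR, RR.
    Lipschitz-P² : ∀ {K f} → 0ℚ ≤ K → Lipschitz K f → Lipschitz (K * ((+ 3) / 5)) (P (P f))
    Lipschitz-P² {K} {f} 0≤K lip p q = begin
      (P (P f) p - P (P f) q) * s                      ≡⟨ expand (f (L (L p))) (f (R (L p))) (f (L (R p))) (f (R (R p)))
                                                           (f (L (L q))) (f (R (L q))) (f (L (R q))) (f (R (R q))) s ⟩
      ½ * ½ * (X LL + X RL + X LR + X RR)              ≤⟨ *-monoˡ-≤-0≤ (*-nonNeg 0≤½ 0≤½) grandchildren ⟩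
      ½ * ½ * (Y + (+ 1) / 5 * Y + (+ 1) / 5 * Y + Y)  ≡⟨ collect K (ℕ→ℚ (Δ p q)) ⟩
      K * ((+ 3) / 5) * ℕ→ℚ (Δ p q)                    ∎
      where
      open ℚP.≤-Reasoning
      s = ℕ→ℚ (σ p q)
      Y = K * ℕ→ℚ (Δ p q)
      LL RL LR RR : Vertex → Vertex
      LL x = L (L x)
      RL x = R (L x)
      LR x = L (R x)
      RR x = R (R x)
      X : (Vertex → Vertex) → ℚ
      X w = (f (w p) - f (w q)) * s
      unit-stretch : ∀ w → Stretches 1 w → Preserves-Δ w → X w ≤ Y
      unit-stretch w stretch keepΔ =
        subst (_≤ Y) (ℚP.*-identityˡ (X w)) (Lipschitz-stretch 1 w {f = f} stretch keepΔ 0≤K lip p q)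
      fifth : ∀ w → Stretches 5 w → Preserves-Δ w → X w ≤ (+ 1) / 5 * Y
      fifth w stretch keepΔ =
        subst (_≤ (+ 1) / 5 * Y) (solve 1 (λ x → con ((+ 1) / 5) :* (con (ℕ→ℚ 5) :* x) := x) refl (X w))
          (*-monoˡ-≤-0≤ (fracℕ-≤ 0 1 1 5 ℕ.z≤n) (Lipschitz-stretch 5 w {f = f} stretch keepΔ 0≤K lip p q))
      grandchildren : X LL + X RL + X LR + X RR ≤ Y + (+ 1) / 5 * Y + (+ 1) / 5 * Y + Y
      grandchildren = ℚP.+-mono-≤ (ℚP.+-mono-≤ (ℚP.+-mono-≤
        (unit-stretch LL (Stretches-∘ 1 1 L L σ-L σ-L) (Preserves-Δ-∘ L L Δ-L Δ-L))
        (fifth RL (σ-RL uv≥2) (Preserves-Δ-∘ L R Δ-L Δ-R)))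
        (fifth LR (σ-LR uv≥2) (Preserves-Δ-∘ R L Δ-R Δ-L)))
        (unit-stretch RR (Stretches-∘ 1 1 R R σ-R σ-R) (Preserves-Δ-∘ R R Δ-R Δ-R))
      collect : ∀ K D → ½ * ½ * (K * D + (+ 1) / 5 * (K * D) + (+ 1) / 5 * (K * D) + K * D) ≡ K * ((+ 3) / 5) * D
      collect = solve 2 (λ K D → con ½ :* con ½ :* (K :* D :+ con ((+ 1) / 5) :* (K :* D) :+ con ((+ 1) / 5) :* (K :* D) :+ K :* D)
                                 := K :* con ((+ 3) / 5) :* D) refl
      expand : ∀ a₁ a₂ a₃ a₄ b₁ b₂ b₃ b₄ s →
        (½ * (½ * (a₁ + a₂) + ½ * (a₃ + a₄)) - ½ * (½ * (b₁ + b₂) + ½ * (b₃ + b₄))) * s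
        ≡ ½ * ½ * ((a₁ - b₁) * s + (a₂ - b₂) * s + (a₃ - b₃) * s + (a₄ - b₄) * s)
      expand = solve 9 (λ a₁ a₂ a₃ a₄ b₁ b₂ b₃ b₄ s →
        (con ½ :* (con ½ :* (a₁ :+ a₂) :+ con ½ :* (a₃ :+ a₄)) :- con ½ :* (con ½ :* (b₁ :+ b₂) :+ con ½ :* (b₃ :+ b₄))) :* s
        := con ½ :* con ½ :* ((a₁ :- b₁) :* s :+ (a₂ :- b₂) :* s :+ (a₃ :- b₃) :* s :+ (a₄ :- b₄) :* s)) refl

    Lipschitz-P⁴ : ∀ {K f} → 0ℚ ≤ K → Lipschitz K f → Lipschitz (K * ½) (P (P (P (P f))))
    Lipschitz-P⁴ {K} {f} 0≤K lip = Lipschitz-weaken {f = P (P (P (P f)))} 9/25≤½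
      (Lipschitz-P² {f = P (P f)} (*-nonNeg 0≤K (fracℕ-≤ 0 3 1 5 ℕ.z≤n)) (Lipschitz-P² {f = f} 0≤K lip))
      where
      9/25≤½ : K * ((+ 3) / 5) * ((+ 3) / 5) ≤ K * ½
      9/25≤½ = ≤-by-gap (K * ((+ 7) / 50)) (*-nonNeg 0≤K (fracℕ-≤ 0 7 1 50 ℕ.z≤n))
        (solve 1 (λ K → K :* con ½ := K :* con ((+ 3) / 5) :* con ((+ 3) / 5) :+ K :* con ((+ 7) / 50)) refl K)

    Lipschitz-Pⁿ : ∀ i {K f} → 0ℚ ≤ K → Lipschitz K f → Lipschitz (K * ½^ i) (Pⁿ (i ℕ.* 4) f)
    Lipschitz-Pⁿ zero    {K} {f} 0≤K lip =
      Lipschitz-weaken {f = f} (ℚP.≤-reflexive (sym (ℚP.*-identityʳ K))) lip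
    Lipschitz-Pⁿ (suc i) {K} {f} 0≤K lip =
      Lipschitz-weaken {f = Pⁿ (suc i ℕ.* 4) f} (ℚP.≤-reflexive (ℚP.*-assoc K ½ (½^ i)))
        (Lipschitz-Pⁿ i {f = P (P (P (P f)))} (*-nonNeg 0≤K 0≤½) (Lipschitz-P⁴ {f = f} 0≤K lip))

  σ-comm : ∀ p q → σ p q ≡ σ q p
  σ-comm (a , b) (c , d) = ℕP.+-comm (a ℕ.* suc d) (c ℕ.* suc b)

  Lipschitz⇒≤+K : ∀ {K f} → 0ℚ ≤ K → Lipschitz K f → ∀ p q → 1 ℕ.≤ σ p q → f p ≤ f q + K
  Lipschitz⇒≤+K {K} {f} 0≤K lip p q 1≤σ = ≤-by-gap (K - (f p - f q)) (p≤q⇒0≤q-p D≤K)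
    (solve 3 (λ x y K → y :+ K := x :+ (K :- (x :- y))) refl (f p) (f q) K)
    where
    D≤K : f p - f q ≤ K
    D≤K = ℚP.*-cancelʳ-≤-pos (ℕ→ℚ (σ p q)) {{ℕ→ℚ-pos (σ p q) 1≤σ}}
      (ℚP.≤-trans (lip p q) (*-monoˡ-≤-0≤ 0≤K (ℕ→ℚ-mono-≤ (Δ≤σ p q))))

  Lipschitz⇒≈ : ∀ {K f} → 0ℚ ≤ K → Lipschitz K f → ∀ r → 1 ℕ.≤ proj₁ r → ∀ p → f p ≈[ K ] f r
  Lipschitz⇒≈ {f = f} 0≤K lip r 1≤r p =
    Lipschitz⇒≤+K {f = f} 0≤K lip p r (subst (1 ℕ.≤_) (σ-comm r p) (σ-pos r p 1≤r)) ,
    Lipschitz⇒≤+K {f = f} 0≤K lip r p (σ-pos r p 1≤r)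

module Averages (u′ v′ : ℕ) (z : ℚ) (1≤num : 1 ℕ.≤ proj₁ (rootOf z)) where
  open Tree u′ v′

  root : Vertex
  root = rootOf z

  sum-children : ∀ f l → sumℚ (map f (concatMap (children u v) l)) ≡ sumℚ (map (λ p → f (L p) + f (R p)) l)
  sum-children f []      = refl
  sum-children f (p ∷ l) = trans (sym (ℚP.+-assoc (f (L p)) (f (R p)) _))
    (cong (λ s → f (L p) + f (R p) + s) (sum-children f l))

  sum-* : ∀ c (f : Vertex → ℚ) l → sumℚ (map (λ p → c * f p) l) ≡ c * sumℚ (map f l)
  sum-* c f []      = sym (ℚP.*-zeroʳ c)
  sum-* c f (p ∷ l) = trans (cong (λ s → c * f p + s) (sum-* c f l)) (sym (ℚP.*-distribˡ-+ c (f p) _))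

  mean : ℕ → (Vertex → ℚ) → ℚ
  mean n f = ½^ n * sumℚ (map f (level u v z n))

  mean-suc : ∀ n f → mean (suc n) f ≡ mean n (P f)
  mean-suc n f = begin
    ½ * ½^ n * sumℚ (map f (concatMap (children u v) ls))  ≡⟨ cong (½ * ½^ n *_) (sum-children f ls) ⟩
    ½ * ½^ n * sumℚ (map Pf ls)                            ≡⟨ swap ½ (½^ n) (sumℚ (map Pf ls)) ⟩
    ½^ n * (½ * sumℚ (map Pf ls))                          ≡⟨ cong (½^ n *_) (sym (sum-* ½ Pf ls)) ⟩
    mean n (P f)                                           ∎
    where
    open ≡-Reasoning
    ls = level u v z n
    Pf : Vertex → ℚ
    Pf p = f (L p) + f (R p)
    swap : ∀ a b c → a * b * c ≡ b * (a * c)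
    swap = solve 3 (λ a b c → a :* b :* c := b :* (a :* c)) refl

  mean≡Pⁿ : ∀ n f → mean n f ≡ Pⁿ n f root
  mean≡Pⁿ zero    f = solve 1 (λ x → con 1ℚ :* (x :+ con 0ℚ) := x) refl (f root)
  mean≡Pⁿ (suc n) f = trans (mean-suc n f) (mean≡Pⁿ n (P f))

  Ā : ℕ → ℚ
  Ā n = Pⁿ n label root

  A≡Ā : ∀ n → A u v z n ≡ Ā n
  A≡Ā n = trans (cong (_* sumℚ (map label (level u v z n))) (sym (½^≡1/2^ n))) (mean≡Pⁿ n label)

  Lⁿ : ℕ → Vertex → Vertex
  Lⁿ zero    p = p
  Lⁿ (suc j) p = Lⁿ j (L p)

  leftLabel : ℕ → Vertex → ℚ
  leftLabel j p = label (L (Lⁿ j p))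

  G : ℕ → ℚ
  G n = Pⁿ n (leftLabel 0) root

  label-R : ∀ p → label (R p) ≡ label p + ℕ→ℚ v
  label-R (a , b) = sym (trans (fracℕ-+ a v (suc b) 1)
    (fracℕ-≡ (a ℕ.* 1 ℕ.+ v ℕ.* suc b) (a ℕ.+ v ℕ.* suc b) (suc b ℕ.* 1) (suc b) (cross a b v)))
    where
    cross : ∀ a b v → (a ℕ.* 1 ℕ.+ v ℕ.* suc b) ℕ.* suc b ≡ (a ℕ.+ v ℕ.* suc b) ℕ.* (suc b ℕ.* 1)
    cross = solve-∀

  Ā-suc : ∀ n → Ā (suc n) ≡ ½ * Ā n + ½ * (ℕ→ℚ v + G n)
  Ā-suc n = begin
    Pⁿ n (P label) root                                  ≡⟨ Pⁿ-cong n split root ⟩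
    Pⁿ n (λ p → ½ * label p + ½ * g p) root              ≡⟨ Pⁿ-+ n (λ p → ½ * label p) (λ p → ½ * g p) root ⟩
    Pⁿ n (λ p → ½ * label p) root + Pⁿ n (λ p → ½ * g p) root
                                                         ≡⟨ cong₂ _+_ (Pⁿ-* n ½ label root) (Pⁿ-* n ½ g root) ⟩
    ½ * Ā n + ½ * Pⁿ n g root                            ≡⟨ cong (λ x → ½ * Ā n + ½ * x) (Pⁿ-+ n (λ _ → ℕ→ℚ v) (leftLabel 0) root) ⟩
    ½ * Ā n + ½ * (Pⁿ n (λ _ → ℕ→ℚ v) root + G n)        ≡⟨ cong (λ x → ½ * Ā n + ½ * (x + G n)) (Pⁿ-const n (ℕ→ℚ v) root) ⟩
    ½ * Ā n + ½ * (ℕ→ℚ v + G n)                          ∎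
    where
    open ≡-Reasoning
    g : Vertex → ℚ
    g p = ℕ→ℚ v + leftLabel 0 p
    split : ∀ p → P label p ≡ ½ * label p + ½ * g p
    split p = trans (cong (λ x → ½ * (leftLabel 0 p + x)) (label-R p))
      (solve 3 (λ g l w → con ½ :* (g :+ (l :+ w)) := con ½ :* l :+ con ½ :* (w :+ g)) refl (leftLabel 0 p) (label p) (ℕ→ℚ v))

  label-nonNeg : ∀ p → 0ℚ ≤ label p
  label-nonNeg (a , b) = fracℕ-≤ 0 a 1 (suc b) ℕ.z≤n

  label≤num : ∀ p → label p ≤ ℕ→ℚ (proj₁ p)
  label≤num (a , b) = fracℕ-≤ a a (suc b) 1 (ℕP.≤-trans (ℕP.≤-reflexive (ℕP.*-identityʳ a)) (ℕP.m≤m*n a (suc b)))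

  label∘L≤1 : ∀ p → label (L p) ≤ 1ℚ
  label∘L≤1 (a , b) = fracℕ-≤ a 1 (suc (u ℕ.* a ℕ.+ b)) 1 (begin
    a ℕ.* 1                    ≡⟨ ℕP.*-identityʳ a ⟩
    a                          ≤⟨ ℕP.m≤n*m a u ⟩
    u ℕ.* a                    ≤⟨ ℕP.m≤m+n (u ℕ.* a) b ⟩
    u ℕ.* a ℕ.+ b              <⟨ ℕP.n<1+n _ ⟩
    suc (u ℕ.* a ℕ.+ b)        ≡⟨ sym (ℕP.*-identityˡ _) ⟩
    1 ℕ.* suc (u ℕ.* a ℕ.+ b)  ∎)
    where open ℕP.≤-Reasoning

  G-nonNeg : ∀ n → 0ℚ ≤ G n
  G-nonNeg n = Pⁿ-≥-const n 0ℚ (λ p → label-nonNeg (L p)) root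

  G≤1 : ∀ n → G n ≤ 1ℚ
  G≤1 n = Pⁿ-≤-const n 1ℚ label∘L≤1 root

  Ā-nonNeg : ∀ n → 0ℚ ≤ Ā n
  Ā-nonNeg n = Pⁿ-≥-const n 0ℚ label-nonNeg root

  B : ℕ
  B = proj₁ root ℕ.+ suc v

  v+1≤B : ℕ→ℚ v + 1ℚ ≤ ℕ→ℚ B
  v+1≤B = ℚP.≤-trans (ℚP.≤-reflexive (sym (ℕ→ℚ-+ v 1)))
    (ℕ→ℚ-mono-≤ (ℕP.≤-trans (ℕP.≤-reflexive (ℕP.+-comm v 1)) (ℕP.m≤n+m (suc v) (proj₁ root))))

  Ā≤B : ∀ n → Ā n ≤ ℕ→ℚ B
  Ā≤B zero    = ℚP.≤-trans (label≤num root) (ℕ→ℚ-mono-≤ (ℕP.m≤m+n (proj₁ root) (suc v)))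
  Ā≤B (suc n) = begin
    Ā (suc n)                       ≡⟨ Ā-suc n ⟩
    ½ * Ā n + ½ * (ℕ→ℚ v + G n)     ≤⟨ ℚP.+-mono-≤ (*-monoˡ-≤-0≤ 0≤½ (Ā≤B n))
                                         (*-monoˡ-≤-0≤ 0≤½ (ℚP.≤-trans (ℚP.+-monoʳ-≤ (ℕ→ℚ v) (G≤1 n)) v+1≤B)) ⟩
    ½ * ℕ→ℚ B + ½ * ℕ→ℚ B           ≡⟨ ½+½ (ℕ→ℚ B) ⟩
    ℕ→ℚ B                           ∎
    where open ℚP.≤-Reasoning

  Ā≈ : ∀ {c} → 0ℚ ≤ c → c ≤ 1ℚ → ∀ n → Ā n ≈[ ℕ→ℚ B ] ℕ→ℚ v + c
  Ā≈ 0≤c c≤1 n = ≈-within (Ā-nonNeg n) (Ā≤B n) (+-nonNeg (ℕ→ℚ-nonNeg v) 0≤c)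
    (ℚP.≤-trans (ℚP.+-monoʳ-≤ (ℕ→ℚ v) c≤1) v+1≤B)

  open Tracking Ā G (ℕ→ℚ v) Ā-suc

  σ≤denominators : ∀ a b c d → σ (a , b) (c , d) ℕ.≤ suc (u ℕ.* a ℕ.+ b) ℕ.* suc (u ℕ.* c ℕ.+ d)
  σ≤denominators a b c d = ℕP.≤-trans (ℕP.m≤m+n _ _) (ℕP.≤-reflexive (sym (expand a b c d u′)))
    where
    expand : ∀ a b c d u′ → suc (suc u′ ℕ.* a ℕ.+ b) ℕ.* suc (suc u′ ℕ.* c ℕ.+ d)
      ≡ (a ℕ.* suc d ℕ.+ c ℕ.* suc b)
        ℕ.+ (u′ ℕ.* a ℕ.* suc d ℕ.+ u′ ℕ.* c ℕ.* suc b ℕ.+ suc u′ ℕ.* suc u′ ℕ.* a ℕ.* c ℕ.+ suc b ℕ.* suc d)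
    expand = solve-∀

  +m-+n≤+∣m-n∣ : ∀ m n → + m ℤ.- + n ℤ.≤ + ℕ.∣ m - n ∣
  +m-+n≤+∣m-n∣ m n with ℕP.≤-total n m
  ... | inj₁ n≤m = ℤP.≤-reflexive (trans (ℤP.m-n≡m⊖n m n)
                     (trans (ℤP.⊖-≥ n≤m) (cong +_ (sym (ℕP.m≤n⇒∣n-m∣≡n∸m n≤m)))))
  ... | inj₂ m≤n = subst (ℤ._≤ + ℕ.∣ m - n ∣) (sym (trans (ℤP.m-n≡m⊖n m n) (ℤP.⊖-≤ m≤n))) ℤP.neg-≤-pos

  Lipschitz-label∘L : Lipschitz 1ℚ (λ p → label (L p))
  Lipschitz-label∘L p@(a , b) q@(c , d) = subst₂ _≤_ (sym difference) (sym (ℚP.*-identityˡ (ℕ→ℚ (Δ p q))))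
    (frac-≤ ((+ x ℤ.- + y) ℤ.* + σ p q) (+ Δ p q) (D₁ ℕ.* D₂ ℕ.* 1) 1 cross)
    where
    D₁ = suc (u ℕ.* a ℕ.+ b)
    D₂ = suc (u ℕ.* c ℕ.+ d)
    x = a ℕ.* D₂
    y = c ℕ.* D₁
    instance
      D₁D₂≢0 : NonZero (D₁ ℕ.* D₂)
      D₁D₂≢0 = m*n≢0 D₁ D₂
      D₁D₂1≢0 : NonZero (D₁ ℕ.* D₂ ℕ.* 1)
      D₁D₂1≢0 = m*n≢0 (D₁ ℕ.* D₂) 1
    difference : (label (L p) - label (L q)) * ℕ→ℚ (σ p q) ≡ ((+ x ℤ.- + y) ℤ.* + σ p q) / (D₁ ℕ.* D₂ ℕ.* 1)
    difference = begin
      ((+ a) / D₁ + ℚ.- ((+ c) / D₂)) * ℕ→ℚ (σ p q)            ≡⟨ cong (λ t → ((+ a) / D₁ + t) * ℕ→ℚ (σ p q)) (frac-neg (+ c) D₂) ⟩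
      ((+ a) / D₁ + (ℤ.- + c) / D₂) * ℕ→ℚ (σ p q)              ≡⟨ cong (_* ℕ→ℚ (σ p q)) (frac-+ (+ a) (ℤ.- + c) D₁ D₂) ⟩
      ((+ a ℤ.* + D₂ ℤ.+ (ℤ.- + c) ℤ.* + D₁) / (D₁ ℕ.* D₂)) * ℕ→ℚ (σ p q)
                                                                ≡⟨ frac-* (+ a ℤ.* + D₂ ℤ.+ (ℤ.- + c) ℤ.* + D₁) (+ σ p q) (D₁ ℕ.* D₂) 1 ⟩
      ((+ a ℤ.* + D₂ ℤ.+ (ℤ.- + c) ℤ.* + D₁) ℤ.* + σ p q) / (D₁ ℕ.* D₂ ℕ.* 1)
                                                                ≡⟨ frac-cong (cong (ℤ._* + σ p q) numerator) refl ⟩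
      ((+ x ℤ.- + y) ℤ.* + σ p q) / (D₁ ℕ.* D₂ ℕ.* 1)           ∎
      where
      open ≡-Reasoning
      numerator : + a ℤ.* + D₂ ℤ.+ (ℤ.- + c) ℤ.* + D₁ ≡ + x ℤ.- + y
      numerator = cong₂ ℤ._+_ (sym (ℤP.pos-* a D₂)) (trans (sym (ℤP.neg-distribˡ-* (+ c) (+ D₁))) (cong ℤ.-_ (sym (ℤP.pos-* c D₁))))
    cross : (+ x ℤ.- + y) ℤ.* + σ p q ℤ.* + 1 ℤ.≤ + Δ p q ℤ.* + (D₁ ℕ.* D₂ ℕ.* 1)
    cross = begin
      (+ x ℤ.- + y) ℤ.* + σ p q ℤ.* + 1   ≡⟨ ℤP.*-identityʳ _ ⟩
      (+ x ℤ.- + y) ℤ.* + σ p q           ≤⟨ ℤP.*-monoʳ-≤-nonNeg (+ σ p q) (subst (λ k → + x ℤ.- + y ℤ.≤ + k) (Δ-L p q) (+m-+n≤+∣m-n∣ x y)) ⟩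
      + Δ p q ℤ.* + σ p q                 ≤⟨ ℤP.*-monoˡ-≤-nonNeg (+ Δ p q) (ℤ.+≤+ (subst (σ p q ℕ.≤_) (sym (ℕP.*-identityʳ (D₁ ℕ.* D₂))) (σ≤denominators a b c d))) ⟩
      + Δ p q ℤ.* + (D₁ ℕ.* D₂ ℕ.* 1)     ∎
      where open ℤP.≤-Reasoning

  G-flat : 2 ℕ.≤ u ℕ.* v → ∀ i t → G (i ℕ.* 4 ℕ.+ t) ≈[ ½^ i ] G (i ℕ.* 4)
  G-flat uv≥2 i t = subst₂ (_≈[ ½^ i ]_) (sym (Pⁿ-+ℕ (i ℕ.* 4) t (leftLabel 0) root)) (Pⁿ-const t (F root) root)
    (Pⁿ-≈ t (λ p → subst (F p ≈[_] F root) (ℚP.*-identityˡ (½^ i))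
      (Lipschitz⇒≈ {f = F} (*-nonNeg 0≤1 (½^-nonNeg i)) lipschitz root 1≤num p)) root)
    where
    F = Pⁿ (i ℕ.* 4) (leftLabel 0)
    lipschitz : Lipschitz (1ℚ * ½^ i) F
    lipschitz = Lipschitz-Pⁿ uv≥2 i {f = leftLabel 0} 0≤1 Lipschitz-label∘L

  Ā-eventually-near : 2 ℕ.≤ u ℕ.* v →
    ∀ ε → Positive ε → ∃ λ N → ∃ λ c → ∀ m → N ℕ.≤ m → Ā m ≈[ ε ] ℕ→ℚ v + c
  Ā-eventually-near uv≥2 ε pos = proj₁ near , G (i ℕ.* 4) , λ m N≤m → ≈-weaken budget (proj₂ near m N≤m)
    where
    archimedes = archimedean-½^ (½ * ε) (½-pos ε pos) 1
    i = proj₁ archimedes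
    near = eventually-near {b = B} {c = G (i ℕ.* 4)} {N = i ℕ.* 4} (½^-nonNeg i)
      (Ā≈ (G-nonNeg (i ℕ.* 4)) (G≤1 (i ℕ.* 4))) (G-flat uv≥2 i) (½ * ε) (½-pos ε pos)
    budget : ½^ i + ½ * ε ≤ ε
    budget = ℚP.≤-trans (ℚP.+-monoˡ-≤ (½ * ε) (subst (_≤ ½ * ε) (ℚP.*-identityˡ (½^ i)) (proj₂ archimedes)))
      (ℚP.≤-reflexive (½+½ ε))

  A-cauchy : 2 ℕ.≤ u ℕ.* v → IsCauchy (A u v z)
  A-cauchy uv≥2 = near⇒IsCauchy A-near
    where
    A-near : ∀ ε → Positive ε → ∃ λ N → ∃ λ c → ∀ m → N ℕ.≤ m → A u v z m ≈[ ε ] c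
    A-near ε pos = let (N , c , Ā≈c) = Ā-eventually-near uv≥2 ε pos in
      N , ℕ→ℚ v + c , λ m N≤m → subst (_≈[ ε ] ℕ→ℚ v + c) (sym (A≡Ā m)) (Ā≈c m N≤m)

  Lⁿ-closed : ∀ j a b → Lⁿ j (a , b) ≡ (a , j ℕ.* (u ℕ.* a) ℕ.+ b)
  Lⁿ-closed zero    a b = refl
  Lⁿ-closed (suc j) a b = trans (Lⁿ-closed j a (u ℕ.* a ℕ.+ b)) (cong (a ,_) (regroup j (u ℕ.* a) b))
    where
    regroup : ∀ j x b → j ℕ.* x ℕ.+ (x ℕ.+ b) ≡ suc j ℕ.* x ℕ.+ b
    regroup = solve-∀

  e₀ : ℚ
  e₀ = inv (u ℕ.* u ℕ.* v)

  e₀-nonNeg : 0ℚ ≤ e₀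
  e₀-nonNeg = fracℕ-≤ 0 1 1 (u ℕ.* u ℕ.* v) ℕ.z≤n

  μ : ℕ → ℚ
  μ j = inv u * inv (suc j)

  μ≡ : ∀ j → μ j ≡ (+ 1) / (u ℕ.* suc j)
  μ≡ j = frac-* (+ 1) (+ 1) u (suc j)

  -- μ j - N/D = (b+1)/((j+1)u D), and D ≥ (j+1)u N ≥ (j+1)u v (b+1) because N ≥ v (b+1).
  leftLabel-R≈μ : ∀ j p → leftLabel j (R p) ≈[ e₀ ] μ j
  leftLabel-R≈μ j (a , b) = ≤-μ+e₀ , μ≤-+e₀
    where
    N = a ℕ.+ v ℕ.* suc b
    D = suc (u ℕ.* N ℕ.+ (j ℕ.* (u ℕ.* N) ℕ.+ b))
    closed : leftLabel j (R (a , b)) ≡ (+ N) / D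
    closed = cong (λ p → label (L p)) (Lⁿ-closed j N b)
    ≤-μ+e₀ : leftLabel j (R (a , b)) ≤ μ j + e₀
    ≤-μ+e₀ = ℚP.≤-trans (ℚP.≤-reflexive closed) (ℚP.≤-trans
      (fracℕ-≤ N 1 D (u ℕ.* suc j) (ℕP.≤-trans (ℕP.m≤m+n _ (suc b)) (ℕP.≤-reflexive (sym (expand N u j b)))))
      (ℚP.≤-trans (ℚP.≤-reflexive (sym (μ≡ j))) (≤-by-gap e₀ e₀-nonNeg refl)))
      where
      expand : ∀ N u j b → 1 ℕ.* suc (u ℕ.* N ℕ.+ (j ℕ.* (u ℕ.* N) ℕ.+ b)) ≡ N ℕ.* (u ℕ.* suc j) ℕ.+ suc b
      expand = solve-∀
    μ≤-+e₀ : μ j ≤ leftLabel j (R (a , b)) + e₀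
    μ≤-+e₀ = subst₂ _≤_ (sym (μ≡ j)) (sym (trans (cong (_+ e₀) closed) (fracℕ-+ N 1 D (u ℕ.* u ℕ.* v))))
      (fracℕ-≤ 1 (N ℕ.* (u ℕ.* u ℕ.* v) ℕ.+ 1 ℕ.* D) (u ℕ.* suc j) (D ℕ.* (u ℕ.* u ℕ.* v))
        (ℕP.≤-trans (ℕP.m≤m+n _ _) (ℕP.≤-reflexive (sym (expand a b j u v)))))
      where
      expand : ∀ a b j u v →
        ((a ℕ.+ v ℕ.* suc b) ℕ.* (u ℕ.* u ℕ.* v) ℕ.+ 1 ℕ.* suc (u ℕ.* (a ℕ.+ v ℕ.* suc b) ℕ.+ (j ℕ.* (u ℕ.* (a ℕ.+ v ℕ.* suc b)) ℕ.+ b)))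
          ℕ.* (u ℕ.* suc j)
        ≡ 1 ℕ.* (suc (u ℕ.* (a ℕ.+ v ℕ.* suc b) ℕ.+ (j ℕ.* (u ℕ.* (a ℕ.+ v ℕ.* suc b)) ℕ.+ b)) ℕ.* (u ℕ.* u ℕ.* v))
          ℕ.+ (u ℕ.* suc j ℕ.* suc b ℕ.+ suc j ℕ.* suc j ℕ.* u ℕ.* u ℕ.* a ℕ.+ j ℕ.* (j ℕ.+ 2) ℕ.* u ℕ.* u ℕ.* v ℕ.* suc b)
      expand = solve-∀

  inv-u-nonNeg : 0ℚ ≤ inv u
  inv-u-nonNeg = inv-nonNeg u′

  Pⁿ-leftLabel≈ : ∀ n j q → Pⁿ n (leftLabel j) q ≈[ e₀ + ½^ n ] inv u * euler n j
  Pⁿ-leftLabel≈ zero j q = ≈-within (label-nonNeg (L (Lⁿ j q)))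
    (ℚP.≤-trans (label∘L≤1 (Lⁿ j q)) (≤-by-gap e₀ e₀-nonNeg (ℚP.+-comm e₀ 1ℚ)))
    (ℚP.≤-reflexive (sym (ℚP.*-zeroʳ (inv u))))
    (ℚP.≤-trans (ℚP.≤-reflexive (ℚP.*-zeroʳ (inv u))) (+-nonNeg e₀-nonNeg 0≤1))
  Pⁿ-leftLabel≈ (suc n) j q =
    subst (Pⁿ (suc n) (leftLabel j) q ≈[ e₀ + ½^ suc n ]_) target (≈-weaken (ℚP.≤-reflexive error) (≈-trans
      (Pⁿ-≈ n (λ p → ≈-*ˡ ½ 0≤½ (≈-+ˡ (leftLabel (suc j) p) (leftLabel-R≈μ j p))) q)
      (subst (_≈[ ½ * (e₀ + ½^ n) ] ½ * (inv u * euler n (suc j) + μ j)) (sym averaged)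
        (≈-*ˡ ½ 0≤½ (≈-+ʳ (μ j) (Pⁿ-leftLabel≈ n (suc j) q))))))
    where
    averaged : Pⁿ n (λ p → ½ * (leftLabel (suc j) p + μ j)) q ≡ ½ * (Pⁿ n (leftLabel (suc j)) q + μ j)
    averaged = trans (Pⁿ-* n ½ (λ p → leftLabel (suc j) p + μ j) q) (cong (½ *_) (Pⁿ-+const n (leftLabel (suc j)) (μ j) q))
    target : ½ * (inv u * euler n (suc j) + μ j) ≡ inv u * euler (suc n) j
    target = solve 3 (λ i e t → con ½ :* (i :* e :+ i :* t) := i :* (con ½ :* t :+ con ½ :* e)) refl
      (inv u) (euler n (suc j)) (inv (suc j))
    error : ½ * e₀ + ½ * (e₀ + ½^ n) ≡ e₀ + ½^ suc n
    error = solve 2 (λ e h → con ½ :* e :+ con ½ :* (e :+ h) := e :+ con ½ :* h) refl e₀ (½^ n)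

  G≈euler : ∀ K t → G (K ℕ.+ t) ≈[ e₀ + (½^ K + ½^ K) ] inv u * euler K 0
  G≈euler K t = ≈-weaken error-bound
    (≈-trans (Pⁿ-leftLabel≈ (K ℕ.+ t) 0 root) (≈-*ˡ (inv u) inv-u-nonNeg (euler-+-≈ K t 0)))
    where
    error-bound : e₀ + ½^ (K ℕ.+ t) + inv u * ½^ K ≤ e₀ + (½^ K + ½^ K)
    error-bound = ℚP.≤-trans (ℚP.+-mono-≤ (ℚP.+-monoʳ-≤ e₀ (½^-+ K t))
      (ℚP.≤-trans (*-monoʳ-≤-0≤ (½^-nonNeg K) (inv≤1 u′)) (ℚP.≤-reflexive (ℚP.*-identityˡ (½^ K)))))
      (ℚP.≤-reflexive (ℚP.+-assoc e₀ (½^ K) (½^ K)))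

  A-limit : ∀ ε → Positive ε → ∃ λ N → ∀ n m → N ℕ.≤ n → N ℕ.≤ m →
            ∣ (ℕ→ℚ v + altH m * inv u) - A u v z n ∣ ≤ 1ℚ * e₀ + ε
  A-limit ε pos = suc K ℕ.⊔ M , bound
    where
    archimedes = archimedean-inv (½ * ε) (½-pos ε pos) 4
    K = proj₁ archimedes
    I = inv (suc K)
    c = inv u * euler K 0
    η = e₀ + (½^ K + ½^ K)
    0≤c : 0ℚ ≤ c
    0≤c = *-nonNeg inv-u-nonNeg (euler-nonNeg K 0)
    c≤1 : c ≤ 1ℚ
    c≤1 = ℚP.≤-trans (*-monoˡ-≤-0≤ inv-u-nonNeg (euler≤inv K 0))
      (ℚP.≤-trans (ℚP.≤-reflexive (ℚP.*-identityʳ (inv u))) (inv≤1 u′))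
    0≤η : 0ℚ ≤ η
    0≤η = +-nonNeg e₀-nonNeg (+-nonNeg (½^-nonNeg K) (½^-nonNeg K))
    near = eventually-near {b = B} {c = c} {N = K} 0≤η (Ā≈ 0≤c c≤1) (G≈euler K) (½ * ε) (½-pos ε pos)
    M = proj₁ near
    budget : (I + ½^ K) + (η + ½ * ε) ≤ 1ℚ * e₀ + ε
    budget = begin
      (I + ½^ K) + ((e₀ + (½^ K + ½^ K)) + ½ * ε)  ≤⟨ ℚP.+-mono-≤ (ℚP.+-monoʳ-≤ I h≤I)
                                                       (ℚP.+-monoˡ-≤ (½ * ε) (ℚP.+-monoʳ-≤ e₀ (ℚP.+-mono-≤ h≤I h≤I))) ⟩
      (I + I) + ((e₀ + (I + I)) + ½ * ε)            ≡⟨ collect I e₀ (½ * ε) ⟩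
      1ℚ * e₀ + (ℕ→ℚ 4 * I + ½ * ε)                ≤⟨ ℚP.+-monoʳ-≤ (1ℚ * e₀) (ℚP.+-monoˡ-≤ (½ * ε) (proj₂ archimedes)) ⟩
      1ℚ * e₀ + (½ * ε + ½ * ε)                     ≡⟨ cong (λ x → 1ℚ * e₀ + x) (½+½ ε) ⟩
      1ℚ * e₀ + ε                                   ∎
      where
      open ℚP.≤-Reasoning
      h≤I : ½^ K ≤ I
      h≤I = ½^≤inv K
      collect : ∀ I e x → (I + I) + ((e + (I + I)) + x) ≡ 1ℚ * e + (ℕ→ℚ 4 * I + x)
      collect = solve 3 (λ I e x → (I :+ I) :+ ((e :+ (I :+ I)) :+ x) := con 1ℚ :* e :+ (con (ℕ→ℚ 4) :* I :+ x)) refl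
    bound : ∀ n m → suc K ℕ.⊔ M ℕ.≤ n → suc K ℕ.⊔ M ℕ.≤ m →
            ∣ (ℕ→ℚ v + altH m * inv u) - A u v z n ∣ ≤ 1ℚ * e₀ + ε
    bound n m N≤n N≤m = ℚP.≤-trans
      (subst (λ x → ∣ (ℕ→ℚ v + altH m * inv u) - x ∣ ≤ (I + ½^ K) + (η + ½ * ε)) (sym (A≡Ā n))
        (≈⇒∣-∣≤ (≈-trans altH-side (≈-sym (proj₂ near n (ℕP.≤-trans (ℕP.m≤n⊔m (suc K) M) N≤n))))))
      budget
      where
      altH-side : ℕ→ℚ v + altH m * inv u ≈[ I + ½^ K ] ℕ→ℚ v + c
      altH-side = ≈-+ˡ (ℕ→ℚ v) (≈-weaken
        (ℚP.≤-trans (*-monoʳ-≤-0≤ (+-nonNeg (inv-nonNeg K) (½^-nonNeg K)) (inv≤1 u′)) (ℚP.≤-reflexive (ℚP.*-identityˡ _)))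
        (subst (_≈[ inv u * (I + ½^ K) ] c) (ℚP.*-comm (inv u) (altH m))
          (≈-*ˡ (inv u) inv-u-nonNeg (altH≈euler K m (ℕP.≤-trans (ℕP.m≤m⊔n (suc K) M) N≤m)))))

1≤num-root : ∀ z → Positive z → 1 ℕ.≤ proj₁ (rootOf z)
1≤num-root (ℚ.mkℚ +[1+ _ ] _ _) _ = ℕ.s≤s ℕ.z≤n

theorem2 : ∀ (z : ℚ) → Positive z →
    (∀ (u v : ℕ) → .{{_ : NonZero u}} → .{{_ : NonZero v}} → 1 ℕ.< u ℕ.* v →
      ∃ λ (B : ℚ) → ∀ (n : ℕ) → A u v z n ≤ B)
    × ∃ λ (C : ℚ) → ∀ (u v : ℕ) → .{{_ : NonZero u}} → .{{_ : NonZero v}} → 1 ℕ.< u ℕ.* v →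
      IsCauchy (A u v z)
      × (∀ (ε : ℚ) → Positive ε → ∃ λ (N : ℕ) → ∀ (n m : ℕ) → N ℕ.≤ n → N ℕ.≤ m →
          ∣ (ℕ→ℚ v + altH m * inv u) - A u v z n ∣
            ≤ C * inv (u ℕ.* u ℕ.* v) {{m*n≢0 (u ℕ.* u) v {{m*n≢0 u u}}}} + ε)
theorem2 z z>0 = bounded , 1ℚ , converges
  where
  bounded : ∀ (u v : ℕ) → .{{_ : NonZero u}} → .{{_ : NonZero v}} → 1 ℕ.< u ℕ.* v →
            ∃ λ (B : ℚ) → ∀ (n : ℕ) → A u v z n ≤ B
  bounded (suc u′) (suc v′) _ = ℕ→ℚ B , λ n → subst (_≤ ℕ→ℚ B) (sym (A≡Ā n)) (Ā≤B n)
    where open Averages u′ v′ z (1≤num-root z z>0)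
  converges : ∀ (u v : ℕ) → .{{_ : NonZero u}} → .{{_ : NonZero v}} → 1 ℕ.< u ℕ.* v →
      IsCauchy (A u v z)
      × (∀ (ε : ℚ) → Positive ε → ∃ λ (N : ℕ) → ∀ (n m : ℕ) → N ℕ.≤ n → N ℕ.≤ m →
          ∣ (ℕ→ℚ v + altH m * inv u) - A u v z n ∣
            ≤ 1ℚ * inv (u ℕ.* u ℕ.* v) {{m*n≢0 (u ℕ.* u) v {{m*n≢0 u u}}}} + ε)
  converges (suc u′) (suc v′) uv≥2 = A-cauchy uv≥2 , A-limit
    where open Averages u′ v′ z (1≤num-root z z>0)
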